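{- Let $G$ be a graph containing a 3-cycle on the vertices $a,b,c$, and let $\bar G = G\setminus\{a,b,c\}$ be the graph obtained by deleting these three vertices and all incident edges. Let $x^0$ be an optimal basic feasible solution of $\mathrm{ELP}(G)$ with objective value $z(x^0)$, and let $\bar x$ be an optimal basic feasible solution of $\mathrm{ELP}(\bar G)$ with objective value $\bar z(\bar x)$. Then $\bar z(\bar x)\le z(x^0)-2$.
   Context: For a graph $H$ with vertex set $V(H)$ and edge set $E(H)$, the extended LP relaxation $\mathrm{ELP}(H)$ of the vertex cover problem is: minimize $\sum_{v\in V(H)} x_v$ subject to $x_u+x_v\ge 1$ for every edge $(u,v)\in E(H)$, $\sum_{v\in V(C)} x_v\ge s+1$ for every odd cycle $C$ of $H$ with $2s+1$ vertices, and $x_v\ge 0$ for all $v$. A basic feasible solution (BFS) is a vertex of the feasible polyhedron. -}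

module Defs where

open import Data.Bool using (Bool; true; false; T; not; _∨_; if_then_else_)
open import Data.Nat as ℕ using (ℕ; suc)
open import Data.Integer using (+_)
open import Data.Fin using (Fin; _≟_)
open import Data.List using (List; []; _∷_; foldr; map; length; allFin)
open import Data.List.Relation.Unary.All using (All)
open import Data.List.Relation.Unary.Linked using (Linked)
open import Data.List.Relation.Unary.Unique.Propositional using (Unique)
open import Data.Product using (_×_)
open import Data.Empty using (⊥)
open import Data.Rational using (ℚ; 0ℚ; 1ℚ; ½; _+_; _*_; _≤_; _/_)
open import Relation.Nullary using (¬_; ⌊_⌋)
open import Relation.Binary.PropositionalEquality using (_≡_)

record Graph (n : ℕ) : Set₁ where
  field
    Adj    : Fin n → Fin n → Set
    sym    : ∀ {u v} → Adj u v → Adj v u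
    irrefl : ∀ {v} → ¬ Adj v v
open Graph public

-- We work with induced subgraphs G[S] of a graph G on Fin n, where
-- S : Fin n → Bool is the vertex set.  V(G[S]) = { v | T (S v) },
-- E(G[S]) = edges of G with both endpoints in S.
VSet : ℕ → Set
VSet n = Fin n → Bool

allV : ∀ {n} → VSet n
allV _ = true

delete3 : ∀ {n} → Fin n → Fin n → Fin n → VSet n
delete3 a b c v = not (⌊ v ≟ a ⌋ ∨ ⌊ v ≟ b ⌋ ∨ ⌊ v ≟ c ⌋)

sumℚ : List ℚ → ℚ
sumℚ = foldr _+_ 0ℚ

objective : ∀ {n} → VSet n → (Fin n → ℚ) → ℚ
objective {n} S x = sumℚ (map (λ v → if S v then x v else 0ℚ) (allFin n))

lastOr : ∀ {n} → Fin n → List (Fin n) → Fin n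
lastOr d []       = d
lastOr d (v ∷ vs) = lastOr v vs

Closes : ∀ {n} → Graph n → List (Fin n) → Set
Closes G []       = ⊥
Closes G (v ∷ vs) = Adj G (lastOr v vs) v

IsCycle : ∀ {n} → Graph n → VSet n → List (Fin n) → Set
IsCycle G S cs =
  Unique cs × All (λ v → T (S v)) cs × 3 ℕ.≤ length cs
  × Linked (Adj G) cs × Closes G cs

Feasible : ∀ {n} → Graph n → VSet n → (Fin n → ℚ) → Set
Feasible {n} G S x =
  (∀ (u v : Fin n) → T (S u) → T (S v) → Adj G u v → 1ℚ ≤ x u + x v)
  × (∀ (cs : List (Fin n)) (s : ℕ) → IsCycle G S cs →
       length cs ≡ suc (2 ℕ.* s) → (+ (suc s)) / 1 ≤ sumℚ (map x cs))
  × (∀ (v : Fin n) → T (S v) → 0ℚ ≤ x v)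

-- basic feasible solution = vertex (extreme point) of the feasible
-- polyhedron in ℚ^{V(H)}: x is not the midpoint of two distinct
-- feasible points.  (Coordinates outside V(H) are ignored.)
IsBFS : ∀ {n} → Graph n → VSet n → (Fin n → ℚ) → Set
IsBFS {n} G S x =
  Feasible G S x
  × (∀ (y z : Fin n → ℚ) → Feasible G S y → Feasible G S z →
       (∀ (v : Fin n) → T (S v) → x v ≡ ½ * (y v + z v)) →
       ∀ (v : Fin n) → T (S v) → y v ≡ z v)

IsOptimal : ∀ {n} → Graph n → VSet n → (Fin n → ℚ) → Set
IsOptimal {n} G S x =
  Feasible G S x × (∀ (y : Fin n → ℚ) → Feasible G S y →
                      objective S x ≤ objective S y)

OptimalBFS : ∀ {n} → Graph n → VSet n → (Fin n → ℚ) → Set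
OptimalBFS G S x = IsBFS G S x × IsOptimal G S x

module Submission where

-- Write S = V(G) \ {a,b,c}.  The argument only uses optimality of x̄ and
-- feasibility of x⁰.

open import Defs hiding (sym)
open import Data.Nat as ℕ using (ℕ; zero; suc)
open import Data.Integer using (+_)
open import Data.Fin using (Fin; zero; suc; _≟_; punchIn)
open import Data.Fin.Properties using (punchInᵢ≢i)
open import Data.Bool using (T; if_then_else_)
open import Data.Unit using (tt)
open import Data.List using ([]; _∷_; map; tabulate)
open import Data.List.Properties using (map-tabulate)
open import Data.List.Relation.Unary.All as All using ([]; _∷_)
open import Data.List.Relation.Unary.AllPairs using ([]; _∷_)
open import Data.List.Relation.Unary.Linked using ([-]; _∷_)
open import Data.Product using (_,_)
open import Data.Rational using (ℚ; 0ℚ; _+_; -_; _-_; _≤_; _/_)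
open import Data.Rational.Properties as ℚ
  using (+-assoc; +-identityˡ; +-identityʳ; +-inverseʳ; +-monoʳ-≤; +-monoˡ-≤)
open import Algebra.Properties.CommutativeMonoid.Sum ℚ.+-0-commutativeMonoid
  using (sum; ∑-distrib-+; sum-remove; sum-cong-≗; sum-replicate-zero)
open import Relation.Nullary using (yes; no; ⌊_⌋; contradiction)
open import Relation.Binary.PropositionalEquality
  using (_≡_; _≢_; refl; sym; trans; cong; cong₂; subst; module ≡-Reasoning)

feasible-mono : ∀ {n} (G : Graph n) {S S' : VSet n} (x : Fin n → ℚ) →
  (∀ v → T (S v) → T (S' v)) → Feasible G S' x → Feasible G S x
feasible-mono G x S⊆S' (edge , odd , nonneg) =
  (λ u v u∈S v∈S → edge u v (S⊆S' u u∈S) (S⊆S' v v∈S)) ,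
  (λ cs s (uniq , inS , len , linked , closes) →
     odd cs s (uniq , All.map (S⊆S' _) inS , len , linked , closes)) ,
  (λ v v∈S → nonneg v (S⊆S' v v∈S))

triangle-isCycle : ∀ {n} (G : Graph n) (S : VSet n) {a b c : Fin n} →
  a ≢ b → b ≢ c → a ≢ c → Adj G a b → Adj G b c → Adj G a c →
  T (S a) → T (S b) → T (S c) → IsCycle G S (a ∷ b ∷ c ∷ [])
triangle-isCycle G S a≢b b≢c a≢c ab bc ac a∈S b∈S c∈S =
  ((a≢b ∷ a≢c ∷ []) ∷ (b≢c ∷ []) ∷ [] ∷ []) ,
  (a∈S ∷ b∈S ∷ c∈S ∷ []) ,
  ℕ.s≤s (ℕ.s≤s (ℕ.s≤s ℕ.z≤n)) ,
  (ab ∷ bc ∷ [-]) ,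
  Graph.sym G ac

triangle-bound : ∀ {n} (G : Graph n) (S : VSet n) {a b c : Fin n} (x : Fin n → ℚ) →
  a ≢ b → b ≢ c → a ≢ c → Adj G a b → Adj G b c → Adj G a c →
  T (S a) → T (S b) → T (S c) → Feasible G S x →
  (+ 2) / 1 ≤ x a + x b + x c
triangle-bound G S {a} {b} {c} x a≢b b≢c a≢c ab bc ac a∈S b∈S c∈S (_ , odd , _) =
  subst ((+ 2) / 1 ≤_) sum-triple
    (odd (a ∷ b ∷ c ∷ []) 1 (triangle-isCycle G S a≢b b≢c a≢c ab bc ac a∈S b∈S c∈S) refl)
  where
  sum-triple : x a + (x b + (x c + 0ℚ)) ≡ x a + x b + x c
  sum-triple = begin
    x a + (x b + (x c + 0ℚ)) ≡⟨ cong (λ t → x a + (x b + t)) (+-identityʳ (x c)) ⟩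
    x a + (x b + x c)        ≡⟨ sym (+-assoc (x a) (x b) (x c)) ⟩
    x a + x b + x c          ∎
    where open ≡-Reasoning

sumℚ-tabulate : ∀ {n} (f : Fin n → ℚ) → sumℚ (tabulate f) ≡ sum f
sumℚ-tabulate {zero}  f = refl
sumℚ-tabulate {suc n} f = cong (λ t → f zero + t) (sumℚ-tabulate (λ v → f (suc v)))

restrictTo : ∀ {n} → VSet n → (Fin n → ℚ) → Fin n → ℚ
restrictTo S x v = if S v then x v else 0ℚ

objective-sum : ∀ {n} (S : VSet n) (x : Fin n → ℚ) → objective S x ≡ sum (restrictTo S x)
objective-sum {n} S x = begin
  sumℚ (map (restrictTo S x) (tabulate (λ v → v))) ≡⟨ cong sumℚ (map-tabulate (λ v → v) (restrictTo S x)) ⟩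
  sumℚ (tabulate (restrictTo S x))                 ≡⟨ sumℚ-tabulate (restrictTo S x) ⟩
  sum (restrictTo S x)                             ∎
  where open ≡-Reasoning

pointMass : ∀ {n} → Fin n → (Fin n → ℚ) → Fin n → ℚ
pointMass a x v = if ⌊ v ≟ a ⌋ then x v else 0ℚ

sum-pointMass : ∀ {n} (a : Fin n) (x : Fin n → ℚ) → sum (pointMass a x) ≡ x a
sum-pointMass {suc n} a x = begin
  sum (pointMass a x)                                     ≡⟨ sum-remove {i = a} (pointMass a x) ⟩
  pointMass a x a + sum (λ j → pointMass a x (punchIn a j)) ≡⟨ cong₂ _+_ at-a (sum-cong-≗ {n} off-a) ⟩
  x a + sum {n} (λ _ → 0ℚ)                                ≡⟨ cong (λ t → x a + t) (sum-replicate-zero n) ⟩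
  x a + 0ℚ                                                ≡⟨ +-identityʳ (x a) ⟩
  x a                                                     ∎
  where
  open ≡-Reasoning
  at-a : pointMass a x a ≡ x a
  at-a with a ≟ a
  ... | yes _  = refl
  ... | no a≢a = contradiction refl a≢a
  off-a : ∀ j → pointMass a x (punchIn a j) ≡ 0ℚ
  off-a j with punchIn a j ≟ a
  ... | yes p = contradiction p (punchInᵢ≢i a j)
  ... | no _  = refl

triangle-decomposition : ∀ {n} {a b c : Fin n} → a ≢ b → b ≢ c → a ≢ c →
  (x : Fin n → ℚ) (v : Fin n) →
  x v ≡ restrictTo (delete3 a b c) x v + (pointMass a x v + pointMass b x v + pointMass c x v)
triangle-decomposition {a = a} {b} {c} a≢b b≢c a≢c x v with v ≟ a | v ≟ b | v ≟ c
... | yes refl | yes refl | _        = contradiction refl a≢b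
... | yes refl | _        | yes refl = contradiction refl a≢c
... | _        | yes refl | yes refl = contradiction refl b≢c
... | yes refl | no _     | no _     =
  sym (trans (+-identityˡ _) (trans (+-identityʳ _) (+-identityʳ _)))
... | no _     | yes refl | no _     =
  sym (trans (+-identityˡ _) (trans (+-identityʳ _) (+-identityˡ _)))
... | no _     | no _     | yes refl =
  sym (trans (+-identityˡ _) (+-identityˡ _))
... | no _     | no _     | no _     =
  sym (trans (cong (λ t → x v + t) (trans (+-identityʳ (0ℚ + 0ℚ)) (+-identityʳ 0ℚ))) (+-identityʳ (x v)))

objective-delete3 : ∀ {n} {a b c : Fin n} → a ≢ b → b ≢ c → a ≢ c → (x : Fin n → ℚ) →
  objective allV x ≡ objective (delete3 a b c) x + (x a + x b + x c)
objective-delete3 {a = a} {b} {c} a≢b b≢c a≢c x = begin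
  objective allV x                                 ≡⟨ objective-sum allV x ⟩
  sum x                                            ≡⟨ sum-cong-≗ (triangle-decomposition a≢b b≢c a≢c x) ⟩
  sum (λ v → r v + (pa v + pb v + pc v))           ≡⟨ ∑-distrib-+ r (λ v → pa v + pb v + pc v) ⟩
  sum r + sum (λ v → pa v + pb v + pc v)           ≡⟨ cong (λ t → sum r + t) masses ⟩
  sum r + (x a + x b + x c)                        ≡⟨ cong (λ t → t + (x a + x b + x c)) (sym (objective-sum S x)) ⟩
  objective S x + (x a + x b + x c)                ∎
  where
  open ≡-Reasoning
  S  = delete3 a b c
  r  = restrictTo S x
  pa = pointMass a x
  pb = pointMass b x
  pc = pointMass c x
  masses : sum (λ v → pa v + pb v + pc v) ≡ x a + x b + x c
  masses = begin
    sum (λ v → pa v + pb v + pc v)   ≡⟨ ∑-distrib-+ (λ v → pa v + pb v) pc ⟩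
    sum (λ v → pa v + pb v) + sum pc ≡⟨ cong (λ t → t + sum pc) (∑-distrib-+ pa pb) ⟩
    sum pa + sum pb + sum pc         ≡⟨ cong₂ _+_ (cong₂ _+_ (sum-pointMass a x) (sum-pointMass b x)) (sum-pointMass c x) ⟩
    x a + x b + x c                  ∎

≤-subtract : ∀ {p q : ℚ} (r : ℚ) → p + r ≤ q → p ≤ q - r
≤-subtract {p} {q} r p+r≤q = begin
  p             ≡⟨ sym (+-identityʳ p) ⟩
  p + 0ℚ        ≡⟨ cong (λ t → p + t) (sym (+-inverseʳ r)) ⟩
  p + (r - r)   ≡⟨ sym (+-assoc p r (- r)) ⟩
  (p + r) - r   ≤⟨ +-monoˡ-≤ (- r) p+r≤q ⟩
  q - r         ∎
  where open ℚ.≤-Reasoning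

lemma1 : ∀ (n : ℕ) (G : Graph n) (a b c : Fin n) →
    a ≢ b → b ≢ c → a ≢ c →
    Adj G a b → Adj G b c → Adj G a c →
    (x⁰ x̄ : Fin n → ℚ) →
    OptimalBFS G allV x⁰ →
    OptimalBFS G (delete3 a b c) x̄ →
    objective (delete3 a b c) x̄ ≤ objective allV x⁰ - (+ 2) / 1
lemma1 n G a b c a≢b b≢c a≢c ab bc ac x⁰ x̄ (_ , x⁰-feasible , _) (_ , _ , x̄-minimal) =
  ≤-subtract ((+ 2) / 1) (begin
    objective S x̄ + (+ 2) / 1            ≤⟨ +-monoˡ-≤ ((+ 2) / 1) x̄≤x⁰ ⟩
    objective S x⁰ + (+ 2) / 1           ≤⟨ +-monoʳ-≤ (objective S x⁰) triangle ⟩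
    objective S x⁰ + (x⁰ a + x⁰ b + x⁰ c) ≡⟨ sym (objective-delete3 a≢b b≢c a≢c x⁰) ⟩
    objective allV x⁰                     ∎)
  where
  open ℚ.≤-Reasoning
  S = delete3 a b c
  x̄≤x⁰ : objective S x̄ ≤ objective S x⁰
  x̄≤x⁰ = x̄-minimal x⁰ (feasible-mono G x⁰ (λ _ _ → tt) x⁰-feasible)
  triangle : (+ 2) / 1 ≤ x⁰ a + x⁰ b + x⁰ c
  triangle = triangle-bound G allV x⁰ a≢b b≢c a≢c ab bc ac tt tt tt x⁰-feasible
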